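{- Let $G=(V,E)$ be a $P(2,1)$-graph. Then (1) $G$ is $2$-edge-connected; (2) if $X\subseteq V$ is critical then $G[X]$ is connected; (3) if $X\subseteq V$ is semi-critical then either $G[X]$ is connected or $G[X]$ has exactly two connected components, with vertex sets $A$ and $B$, such that $A$ is over-critical and $B$ is critical.
   Context: Graphs are finite multigraphs, loops allowed. A graph is $(k,\ell)$-sparse if every subgraph $(V',E')$ with at least one edge has $|E'|\le k|V'|-\ell$, and $(k,\ell)$-tight if also $|E|=k|V|-\ell$. A $P(2,1)$-graph is a $(2,1)$-tight graph $G$ such that $G-e$ is $(2,2)$-tight for some edge $e$. For nonempty $X\subseteq V$, $G[X]$ is the induced subgraph and $i(X)$ its number of edges; $X$ is over-critical if $i(X)=2|X|-1$, critical if $i(X)=2|X|-2$, semi-critical if $i(X)=2|X|-3$. -}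

module Defs where

open import Data.Nat using (ℕ; _+_; _*_; _≤_)
open import Data.Fin using (Fin)
open import Data.Fin.Subset using (Subset; _∈_; _⊆_; ∣_∣; ⊤; ∁; ⁅_⁆; Nonempty; Empty; _∩_; _∪_)
open import Data.Bool using (_∧_)
open import Data.Vec using (tabulate; lookup)
open import Data.Product using (_×_; _,_; proj₁; proj₂; ∃)
open import Data.Sum using (_⊎_)
open import Relation.Binary.PropositionalEquality using (_≡_)

-- A finite multigraph (loops allowed) on vertex set Fin n with m edges,
-- given by the endpoint function of its edges.
Graph : ℕ → ℕ → Set
Graph n m = Fin m → Fin n × Fin n

module _ {n m : ℕ} (G : Graph n m) where

  inducedEdges : Subset n → Subset m
  inducedEdges X = tabulate (λ j → lookup X (proj₁ (G j)) ∧ lookup X (proj₂ (G j)))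

  i : Subset n → ℕ
  i X = ∣ inducedEdges X ∣

  Sparse : ℕ → ℕ → Subset m → Set
  Sparse k ℓ F = (X : Subset n) (F' : Subset m) → F' ⊆ F → F' ⊆ inducedEdges X →
                 Nonempty F' → ∣ F' ∣ + ℓ ≤ k * ∣ X ∣

  Tight : ℕ → ℕ → Subset m → Set
  Tight k ℓ F = Sparse k ℓ F × ∣ F ∣ + ℓ ≡ k * n

  minusEdge : Fin m → Subset m
  minusEdge e = ∁ ⁅ e ⁆

  IsP21 : Set
  IsP21 = Tight 2 1 ⊤ × ∃ λ e → Tight 2 2 (minusEdge e)

  data Reach (F : Subset m) : Fin n → Fin n → Set where
    here : ∀ {u} → Reach F u u
    step : ∀ {u w v} (e : Fin m) → e ∈ F → (G e ≡ (u , w) ⊎ G e ≡ (w , u)) →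
           Reach F w v → Reach F u v

  ConnectedOn : Subset n → Subset m → Set
  ConnectedOn X F = ∀ u v → u ∈ X → v ∈ X → Reach F u v

  InducedConnected : Subset n → Set
  InducedConnected X = ConnectedOn X (inducedEdges X)

  TwoEdgeConnected : Set
  TwoEdgeConnected = ConnectedOn ⊤ ⊤ × (∀ e → ConnectedOn ⊤ (minusEdge e))

  OverCritical Critical SemiCritical : Subset n → Set
  OverCritical X = i X + 1 ≡ 2 * ∣ X ∣
  Critical X = i X + 2 ≡ 2 * ∣ X ∣
  SemiCritical X = i X + 3 ≡ 2 * ∣ X ∣

  TwoComponents : Subset n → Subset n → Subset n → Set
  TwoComponents X A B =
    Nonempty A × Nonempty B × Empty (A ∩ B) × A ∪ B ≡ X ×
    InducedConnected A × InducedConnected B ×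
    (∀ e → e ∈ inducedEdges X → e ∈ inducedEdges A ⊎ e ∈ inducedEdges B)

-- Let G be (2,1)-sparse and G - e be (2,2)-sparse.  Then a nonempty vertex
-- set spans at most 2|Y| - 1 edges, and at most 2|Y| - 2 if it does not
-- contain both endpoints of e.  Two disjoint nonempty sets A, B cannot both
-- contain e, so together they span at most 2(|A| + |B|) - 3 edges.
--
-- Connectivity is obtained from a dichotomy valid in every graph: a
-- subgraph (Y, F) is either connected, or Y splits into two nonempty
-- disjoint parts A, B such that every edge of F lies inside A or inside B
-- (a separation); A is the component of a vertex, computed by exploring
-- along edges of F.  A separation gives |F| ≤ i(A) + i(B) ≤ 2|Y| - 3, so
-- any (Y, F) with |F| ≥ 2|Y| - 2 is connected.  This yields 2-edge-
-- connectivity (F = E or E - f) and connectivity of critical sets.  For a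
-- semi-critical X a separation of G[X] forces every inequality above to be
-- an equality, so one part is over-critical and the other critical; both
-- are then connected, being critical or better.
module Submission where

open import Defs
open import Data.Nat using (ℕ; zero; suc; _+_; _*_; _∸_; _≤_; _<_; z≤n; s≤s)
open import Data.Nat.Properties
open import Algebra.Properties.CommutativeSemigroup +-commutativeSemigroup using (interchange)
open import Data.Bool using (true; false; _∧_)
open import Data.Bool.Properties using (∧-conicalˡ; ∧-conicalʳ)
open import Data.Vec using (_∷_; []; lookup)
open import Data.Vec.Properties using (lookup∘tabulate; []=⇒lookup; lookup⇒[]=)
open import Data.Fin using (Fin)
open import Data.Fin.Properties using (any?)
open import Data.Fin.Subset using (Subset; _∈_; _∉_; _⊆_; ∣_∣; ⊤; ∁; ⁅_⁆; Nonempty; Empty; _∩_; _∪_)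
open import Data.Fin.Subset.Properties
open import Data.Product using (_×_; _,_; proj₁; proj₂; ∃; Σ; ∃₂)
open import Data.Sum using (_⊎_; inj₁; inj₂)
open import Data.Empty using (⊥; ⊥-elim)
open import Function using (id)
open import Relation.Nullary using (Dec; yes; no; ¬_)
open import Relation.Nullary.Decidable using (_×-dec_; _⊎-dec_; ¬?; decidable-stable)
open import Relation.Binary.PropositionalEquality

∣p∪q∣+∣p∩q∣≡∣p∣+∣q∣ : ∀ {k} (p q : Subset k) → ∣ p ∪ q ∣ + ∣ p ∩ q ∣ ≡ ∣ p ∣ + ∣ q ∣
∣p∪q∣+∣p∩q∣≡∣p∣+∣q∣ [] [] = refl
∣p∪q∣+∣p∩q∣≡∣p∣+∣q∣ (false ∷ p) (false ∷ q) = ∣p∪q∣+∣p∩q∣≡∣p∣+∣q∣ p q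
∣p∪q∣+∣p∩q∣≡∣p∣+∣q∣ (true ∷ p) (false ∷ q) = cong suc (∣p∪q∣+∣p∩q∣≡∣p∣+∣q∣ p q)
∣p∪q∣+∣p∩q∣≡∣p∣+∣q∣ (false ∷ p) (true ∷ q) =
  trans (cong suc (∣p∪q∣+∣p∩q∣≡∣p∣+∣q∣ p q)) (sym (+-suc ∣ p ∣ ∣ q ∣))
∣p∪q∣+∣p∩q∣≡∣p∣+∣q∣ (true ∷ p) (true ∷ q) = cong suc (begin
  ∣ p ∪ q ∣ + suc ∣ p ∩ q ∣  ≡⟨ +-suc ∣ p ∪ q ∣ ∣ p ∩ q ∣ ⟩
  suc (∣ p ∪ q ∣ + ∣ p ∩ q ∣) ≡⟨ cong suc (∣p∪q∣+∣p∩q∣≡∣p∣+∣q∣ p q) ⟩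
  suc (∣ p ∣ + ∣ q ∣)         ≡⟨ sym (+-suc ∣ p ∣ ∣ q ∣) ⟩
  ∣ p ∣ + suc ∣ q ∣           ∎)
  where open ≡-Reasoning

∣p∪q∣≤∣p∣+∣q∣ : ∀ {k} (p q : Subset k) → ∣ p ∪ q ∣ ≤ ∣ p ∣ + ∣ q ∣
∣p∪q∣≤∣p∣+∣q∣ p q =
  ≤-trans (m≤m+n ∣ p ∪ q ∣ ∣ p ∩ q ∣) (≤-reflexive (∣p∪q∣+∣p∩q∣≡∣p∣+∣q∣ p q))

empty⇒∣p∣≡0 : ∀ {k} {p : Subset k} → Empty p → ∣ p ∣ ≡ 0
empty⇒∣p∣≡0 {k} empty = trans (cong ∣_∣ (Empty-unique empty)) (∣⊥∣≡0 k)

disjoint⇒∣p∪q∣≡∣p∣+∣q∣ : ∀ {k} (p q : Subset k) → Empty (p ∩ q) → ∣ p ∪ q ∣ ≡ ∣ p ∣ + ∣ q ∣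
disjoint⇒∣p∪q∣≡∣p∣+∣q∣ p q disjoint = begin
  ∣ p ∪ q ∣                ≡⟨ sym (+-identityʳ ∣ p ∪ q ∣) ⟩
  ∣ p ∪ q ∣ + 0            ≡⟨ cong (∣ p ∪ q ∣ +_) (sym (empty⇒∣p∣≡0 disjoint)) ⟩
  ∣ p ∪ q ∣ + ∣ p ∩ q ∣     ≡⟨ ∣p∪q∣+∣p∩q∣≡∣p∣+∣q∣ p q ⟩
  ∣ p ∣ + ∣ q ∣             ∎
  where open ≡-Reasoning

nonempty⇒1≤∣p∣ : ∀ {k} {p : Subset k} → Nonempty p → 1 ≤ ∣ p ∣
nonempty⇒1≤∣p∣ {p = p} (x , x∈p) = subst (_≤ ∣ p ∣) (∣⁅x⁆∣≡1 x)
  (p⊆q⇒∣p∣≤∣q∣ (λ y∈⁅x⁆ → subst (_∈ p) (sym (x∈⁅y⁆⇒x≡y x y∈⁅x⁆)) x∈p))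

-- Two vertex sets with edge counts a, b and sizes s, t, one of which
-- spans at most 2s - 1 edges and the other at most 2t - 2 (for R = _≤_),
-- or exactly that many (for R = _≡_).
data Deficiencies (R : ℕ → ℕ → Set) (a b s t : ℕ) : Set where
  one-two : R (a + 1) (2 * s) → R (b + 2) (2 * t) → Deficiencies R a b s t
  two-one : R (a + 2) (2 * s) → R (b + 1) (2 * t) → Deficiencies R a b s t

bounds-sum : ∀ {x y k l s t} → x + k ≤ 2 * s → y + l ≤ 2 * t → (x + y) + (k + l) ≤ 2 * (s + t)
bounds-sum {x} {y} {k} {l} {s} {t} p q = begin
  (x + y) + (k + l)   ≡⟨ interchange x y k l ⟩
  (x + k) + (y + l)   ≤⟨ +-mono-≤ p q ⟩
  2 * s + 2 * t       ≡⟨ sym (*-distribˡ-+ 2 s t) ⟩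
  2 * (s + t)         ∎
  where open ≤-Reasoning

deficiencies-sum : ∀ {a b s t} → Deficiencies _≤_ a b s t → a + b + 3 ≤ 2 * (s + t)
deficiencies-sum {a} {b} {s} {t} (one-two p q) = bounds-sum {a} {b} {1} {2} {s} {t} p q
deficiencies-sum {a} {b} {s} {t} (two-one p q) = bounds-sum {a} {b} {2} {1} {s} {t} p q

deficiencies-too-large : ∀ {a b s t c} → Deficiencies _≤_ a b s t → c ≤ a + b →
                         2 * (s + t) ≤ c + 2 → ⊥
deficiencies-too-large {a} {b} {s} {t} {c} d c≤a+b dense with
  +-cancelˡ-≤ (a + b) 3 2 (≤-trans (deficiencies-sum d) (≤-trans dense (+-monoˡ-≤ 2 c≤a+b)))
... | s≤s (s≤s ())

sum-tight : ∀ {x y X Y} → x ≤ X → y ≤ Y → X + Y ≤ x + y → x ≡ X × y ≡ Y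
sum-tight {x} {y} {X} {Y} x≤X y≤Y sum≤ =
  ≤-antisym x≤X (+-cancelʳ-≤ Y X x (≤-trans sum≤ (+-monoʳ-≤ x y≤Y))) ,
  ≤-antisym y≤Y (+-cancelˡ-≤ X Y y (≤-trans sum≤ (+-monoˡ-≤ y x≤X)))

deficiencies-tight : ∀ {a b s t c} → Deficiencies _≤_ a b s t → c ≤ a + b →
                     c + 3 ≡ 2 * (s + t) → Deficiencies _≡_ a b s t
deficiencies-tight {a} {b} {s} {t} {c} d c≤a+b semi = tighten d
  where
  room : ∀ k l → k + l ≡ 3 → 2 * s + 2 * t ≤ (a + k) + (b + l)
  room k l k+l≡3 = begin
    2 * s + 2 * t       ≡⟨ sym (*-distribˡ-+ 2 s t) ⟩
    2 * (s + t)         ≡⟨ sym semi ⟩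
    c + 3               ≤⟨ +-monoˡ-≤ 3 c≤a+b ⟩
    (a + b) + 3         ≡⟨ cong (a + b +_) (sym k+l≡3) ⟩
    (a + b) + (k + l)   ≡⟨ interchange a b k l ⟩
    (a + k) + (b + l)   ∎
    where open ≤-Reasoning
  tighten : Deficiencies _≤_ a b s t → Deficiencies _≡_ a b s t
  tighten (one-two p q) = let (p′ , q′) = sum-tight p q (room 1 2 refl) in one-two p′ q′
  tighten (two-one p q) = let (p′ , q′) = sum-tight p q (room 2 1 refl) in two-one p′ q′

module Graphs {n m : ℕ} (G : Graph n m) where

  src tgt : Fin m → Fin n
  src f = proj₁ (G f)
  tgt f = proj₂ (G f)

  ∈inducedEdges⁺ : ∀ {X f} → src f ∈ X → tgt f ∈ X → f ∈ inducedEdges G X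
  ∈inducedEdges⁺ {X} {f} s∈X t∈X = lookup⇒[]= f _
    (trans (lookup∘tabulate _ f) (cong₂ _∧_ ([]=⇒lookup s∈X) ([]=⇒lookup t∈X)))

  ∈inducedEdges⁻ : ∀ {X f} → f ∈ inducedEdges G X → src f ∈ X × tgt f ∈ X
  ∈inducedEdges⁻ {X} {f} f∈ =
    lookup⇒[]= _ X (∧-conicalˡ _ _ both) , lookup⇒[]= _ X (∧-conicalʳ _ _ both)
    where
    both : lookup X (src f) ∧ lookup X (tgt f) ≡ true
    both = trans (sym (lookup∘tabulate _ f)) ([]=⇒lookup f∈)

  reach-trans : ∀ {F u w v} → Reach G F u w → Reach G F w v → Reach G F u v
  reach-trans here r = r
  reach-trans (step f f∈F ends r) r' = step f f∈F ends (reach-trans r r')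

  reach-sym : ∀ {F u v} → Reach G F u v → Reach G F v u
  reach-sym here = here
  reach-sym (step f f∈F (inj₁ ends) r) = reach-trans (reach-sym r) (step f f∈F (inj₂ ends) here)
  reach-sym (step f f∈F (inj₂ ends) r) = reach-trans (reach-sym r) (step f f∈F (inj₁ ends) here)

  Within : Subset m → Subset n → Set
  Within F Y = ∀ {f} → f ∈ F → src f ∈ Y × tgt f ∈ Y

  Closed : Subset m → Subset n → Set
  Closed F S = ∀ {f} → f ∈ F → (src f ∈ S → tgt f ∈ S) × (tgt f ∈ S → src f ∈ S)

  -- A sparsity bound applies to every vertex set whose induced edges it
  -- constrains, also when the set induces no edges at all.
  induced-bound : ∀ {k ℓ F} → Sparse G k ℓ F → ∀ Y → inducedEdges G Y ⊆ F →
                  ℓ ≤ k * ∣ Y ∣ → i G Y + ℓ ≤ k * ∣ Y ∣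
  induced-bound {k} {ℓ} sparse Y ⊆F base with nonempty? (inducedEdges G Y)
  ... | yes some = sparse Y (inducedEdges G Y) ⊆F id some
  ... | no none = subst (λ j → j + ℓ ≤ k * ∣ Y ∣) (sym (empty⇒∣p∣≡0 none)) base

  module Exploration (F : Subset m) (Y : Subset n) (within : Within F Y) (u : Fin n) where

    record Explored (S : Subset n) : Set where
      field
        root    : u ∈ S
        inside  : S ⊆ Y
        reached : ∀ {w} → w ∈ S → Reach G F u w
    open Explored

    Leaving : Subset n → Set
    Leaving S = ∃ λ f → f ∈ F × ((src f ∈ S × tgt f ∉ S) ⊎ (tgt f ∈ S × src f ∉ S))

    leaving? : ∀ S → Dec (Leaving S)
    leaving? S = any? λ f → f ∈? F ×-dec ((src f ∈? S ×-dec ¬? (tgt f ∈? S))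
                                        ⊎-dec (tgt f ∈? S ×-dec ¬? (src f ∈? S)))

    not-leaving⇒closed : ∀ {S} → ¬ Leaving S → Closed F S
    not-leaving⇒closed {S} none {f} f∈F =
      (λ s∈ → decidable-stable (tgt f ∈? S) (λ t∉ → none (f , f∈F , inj₁ (s∈ , t∉)))) ,
      (λ t∈ → decidable-stable (src f ∈? S) (λ s∉ → none (f , f∈F , inj₂ (t∈ , s∉))))

    new-vertex : ∀ {S} → Explored S → Leaving S → ∃ λ y → y ∉ S × y ∈ Y × Reach G F u y
    new-vertex ex (f , f∈F , inj₁ (s∈ , t∉)) =
      tgt f , t∉ , proj₂ (within f∈F) , reach-trans (reached ex s∈) (step f f∈F (inj₁ refl) here)
    new-vertex ex (f , f∈F , inj₂ (t∈ , s∉)) =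
      src f , s∉ , proj₁ (within f∈F) , reach-trans (reached ex t∈) (step f f∈F (inj₂ refl) here)

    add-vertex : ∀ {S y} → Explored S → y ∈ Y → Reach G F u y → Explored (S ∪ ⁅ y ⁆)
    add-vertex {S} {y} ex y∈Y u⇝y = record
      { root = x∈p∪q⁺ (inj₁ (root ex)) ; inside = inside′ ; reached = reached′ }
      where
      inside′ : S ∪ ⁅ y ⁆ ⊆ Y
      inside′ x∈ with x∈p∪q⁻ S ⁅ y ⁆ x∈
      ... | inj₁ x∈S = inside ex x∈S
      ... | inj₂ x∈y = subst (_∈ Y) (sym (x∈⁅y⁆⇒x≡y y x∈y)) y∈Y
      reached′ : ∀ {w} → w ∈ S ∪ ⁅ y ⁆ → Reach G F u w
      reached′ w∈ with x∈p∪q⁻ S ⁅ y ⁆ w∈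
      ... | inj₁ w∈S = reached ex w∈S
      ... | inj₂ w∈y = subst (Reach G F u) (sym (x∈⁅y⁆⇒x≡y y w∈y)) u⇝y

    Component : Set
    Component = Σ (Subset n) λ S → Explored S × Closed F S

    explore : (k : ℕ) (S : Subset n) → n < k + ∣ S ∣ → Explored S → Component
    explore zero S bound ex = ⊥-elim (<⇒≱ bound (∣p∣≤n S))
    explore (suc k) S bound ex with leaving? S
    ... | no none = S , ex , not-leaving⇒closed none
    ... | yes out with new-vertex ex out
    ... | y , y∉S , y∈Y , u⇝y = explore k (S ∪ ⁅ y ⁆) bound′ (add-vertex ex y∈Y u⇝y)
      where
      grows : ∣ S ∣ < ∣ S ∪ ⁅ y ⁆ ∣
      grows = p⊂q⇒∣p∣<∣q∣ ((λ x∈ → x∈p∪q⁺ (inj₁ x∈)) , y , x∈p∪q⁺ (inj₂ (x∈⁅x⁆ y)) , y∉S)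
      bound′ : n < k + ∣ S ∪ ⁅ y ⁆ ∣
      bound′ = ≤-trans bound (subst (_≤ k + ∣ S ∪ ⁅ y ⁆ ∣) (+-suc k ∣ S ∣) (+-monoʳ-≤ k grows))

    -- Start from {u}; n steps suffice since each step adds a vertex.
    component : u ∈ Y → Component
    component u∈Y = explore n ⁅ u ⁆ bound (record
      { root = x∈⁅x⁆ u ; inside = at-u (_∈ Y) u∈Y ; reached = at-u (Reach G F u) here })
      where
      bound : n < n + ∣ ⁅ u ⁆ ∣
      bound = subst (λ z → n < n + z) (sym (∣⁅x⁆∣≡1 u)) (≤-reflexive (+-comm 1 n))
      at-u : (P : Fin n → Set) → P u → ∀ {w} → w ∈ ⁅ u ⁆ → P w
      at-u P Pu w∈ = subst P (sym (x∈⁅y⁆⇒x≡y u w∈)) Pu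

  record Separation (F : Subset m) (Y A B : Subset n) : Set where
    field
      left-nonempty  : Nonempty A
      right-nonempty : Nonempty B
      disjoint       : Empty (A ∩ B)
      covers         : A ∪ B ≡ Y
      splits         : ∀ f → f ∈ F → f ∈ inducedEdges G A ⊎ f ∈ inducedEdges G B
  open Separation

  separation-swap : ∀ {F Y A B} → Separation F Y A B → Separation F Y B A
  separation-swap {F} {Y} {A} {B} sep = record
    { left-nonempty = right-nonempty sep ; right-nonempty = left-nonempty sep
    ; disjoint = subst Empty (∩-comm A B) (disjoint sep)
    ; covers = trans (∪-comm B A) (covers sep)
    ; splits = λ f f∈F → swap (splits sep f f∈F) }
    where
    swap : ∀ {P Q : Set} → P ⊎ Q → Q ⊎ P
    swap (inj₁ p) = inj₂ p
    swap (inj₂ q) = inj₁ q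

  closed-separation : ∀ {F Y S v} → Within F Y → S ⊆ Y → Closed F S → Nonempty S →
                      v ∈ Y → v ∉ S → Separation F Y S (Y ∩ ∁ S)
  closed-separation {F} {Y} {S} {v} within S⊆Y closed nonempty v∈Y v∉S = record
    { left-nonempty = nonempty ; right-nonempty = v , rest v∈Y v∉S
    ; disjoint = λ { (x , x∈) → let (x∈S , x∈rest) = x∈p∩q⁻ S _ x∈ in
                                x∈∁p⇒x∉p (proj₂ (x∈p∩q⁻ Y (∁ S) x∈rest)) x∈S }
    ; covers = ⊆-antisym covered covering ; splits = split }
    where
    rest : ∀ {x} → x ∈ Y → x ∉ S → x ∈ Y ∩ ∁ S
    rest x∈Y x∉S = x∈p∩q⁺ (x∈Y , x∉p⇒x∈∁p x∉S)
    covered : S ∪ (Y ∩ ∁ S) ⊆ Y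
    covered x∈ with x∈p∪q⁻ S _ x∈
    ... | inj₁ x∈S = S⊆Y x∈S
    ... | inj₂ x∈rest = proj₁ (x∈p∩q⁻ Y (∁ S) x∈rest)
    covering : Y ⊆ S ∪ (Y ∩ ∁ S)
    covering {x} x∈Y with x ∈? S
    ... | yes x∈S = x∈p∪q⁺ (inj₁ x∈S)
    ... | no x∉S = x∈p∪q⁺ (inj₂ (rest x∈Y x∉S))
    split : ∀ f → f ∈ F → f ∈ inducedEdges G S ⊎ f ∈ inducedEdges G (Y ∩ ∁ S)
    split f f∈F with src f ∈? S
    ... | yes s∈S = inj₁ (∈inducedEdges⁺ s∈S (proj₁ (closed f∈F) s∈S))
    ... | no s∉S = inj₂ (∈inducedEdges⁺ (rest (proj₁ (within f∈F)) s∉S)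
                                        (rest (proj₂ (within f∈F)) (λ t∈S → s∉S (proj₂ (closed f∈F) t∈S))))

  connected-or-separated : ∀ {F Y} → Within F Y → ConnectedOn G Y F ⊎ ∃₂ (Separation F Y)
  connected-or-separated {F} {Y} within with nonempty? Y
  ... | no empty = inj₁ (λ u _ u∈Y _ → ⊥-elim (empty (u , u∈Y)))
  ... | yes (u , u∈Y) with component u∈Y
    where open Exploration F Y within u
  ... | S , explored , closed with any? (λ v → v ∈? Y ×-dec ¬? (v ∈? S))
  ... | yes (v , v∈Y , v∉S) =
    inj₂ (S , Y ∩ ∁ S , closed-separation within (inside explored) closed (u , root explored) v∈Y v∉S)
    where open Exploration.Explored
  ... | no none = inj₁ λ a b a∈Y b∈Y →
    reach-trans (reach-sym (reached explored (in-S a∈Y))) (reached explored (in-S b∈Y))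
    where
    open Exploration.Explored
    in-S : ∀ {x} → x ∈ Y → x ∈ S
    in-S {x} x∈Y = decidable-stable (x ∈? S) (λ x∉S → none (x , x∈Y , x∉S))

  separation-counts : ∀ {F Y A B} → Separation F Y A B →
                      ∣ F ∣ ≤ i G A + i G B × ∣ A ∣ + ∣ B ∣ ≡ ∣ Y ∣
  separation-counts {F} {Y} {A} {B} sep =
    ≤-trans (p⊆q⇒∣p∣≤∣q∣ (λ {f} f∈F → x∈p∪q⁺ (splits sep f f∈F)))
            (∣p∪q∣≤∣p∣+∣q∣ (inducedEdges G A) (inducedEdges G B)) ,
    trans (sym (disjoint⇒∣p∪q∣≡∣p∣+∣q∣ A B (disjoint sep))) (cong ∣_∣ (covers sep))

  two-components : ∀ {X A B} → Separation (inducedEdges G X) X A B →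
                   InducedConnected G A → InducedConnected G B → TwoComponents G X A B
  two-components sep A-connected B-connected =
    left-nonempty sep , right-nonempty sep , disjoint sep , covers sep ,
    A-connected , B-connected , splits sep

∣minusEdge∣ : ∀ {n m} (G : Graph n m) (f : Fin m) → ∣ minusEdge G f ∣ + 1 ≡ m
∣minusEdge∣ {m = suc m} G f = begin
  ∣ ∁ ⁅ f ⁆ ∣ + 1      ≡⟨ cong (_+ 1) (∣∁p∣≡n∸∣p∣ ⁅ f ⁆) ⟩
  suc m ∸ ∣ ⁅ f ⁆ ∣ + 1 ≡⟨ cong (λ k → suc m ∸ k + 1) (∣⁅x⁆∣≡1 f) ⟩
  m + 1               ≡⟨ +-comm m 1 ⟩
  suc m               ∎
  where open ≡-Reasoning

module Sparse21 {n m : ℕ} (G : Graph n m) (sparse₁ : Sparse G 2 1 ⊤) (e : Fin m)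
                (sparse₂ : Sparse G 2 2 (minusEdge G e)) where
  open Graphs G

  spanned≤ : ∀ Y → Nonempty Y → i G Y + 1 ≤ 2 * ∣ Y ∣
  spanned≤ Y nonempty = induced-bound {2} {1} sparse₁ Y (λ _ → ∈⊤)
    (≤-trans (s≤s z≤n) (*-monoʳ-≤ 2 (nonempty⇒1≤∣p∣ nonempty)))

  spanned≤-without-e : ∀ Y → Nonempty Y → e ∉ inducedEdges G Y → i G Y + 2 ≤ 2 * ∣ Y ∣
  spanned≤-without-e Y nonempty e∉ = induced-bound {2} {2} sparse₂ Y avoids-e
    (*-monoʳ-≤ 2 (nonempty⇒1≤∣p∣ nonempty))
    where
    avoids-e : inducedEdges G Y ⊆ minusEdge G e
    avoids-e f∈ = x∉p⇒x∈∁p (λ f∈e → e∉ (subst (_∈ inducedEdges G Y) (x∈⁅y⁆⇒x≡y e f∈e) f∈))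

  -- Only one of two disjoint sets can contain the edge e.
  disjoint-deficiencies : ∀ A B → Nonempty A → Nonempty B → Empty (A ∩ B) →
                          Deficiencies _≤_ (i G A) (i G B) ∣ A ∣ ∣ B ∣
  disjoint-deficiencies A B A≠∅ B≠∅ disjoint with e ∈? inducedEdges G A
  ... | yes e∈A = one-two (spanned≤ A A≠∅) (spanned≤-without-e B B≠∅ e∉B)
    where
    e∉B : e ∉ inducedEdges G B
    e∉B e∈B = disjoint (src e , x∈p∩q⁺ (proj₁ (∈inducedEdges⁻ e∈A) , proj₁ (∈inducedEdges⁻ e∈B)))
  ... | no e∉A = two-one (spanned≤-without-e A A≠∅ e∉A) (spanned≤ B B≠∅)

  separation-deficiencies : ∀ {F Y A B} → Separation F Y A B →
                            Deficiencies _≤_ (i G A) (i G B) ∣ A ∣ ∣ B ∣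
  separation-deficiencies {A = A} {B} sep =
    disjoint-deficiencies A B (left-nonempty sep) (right-nonempty sep) (disjoint sep)
    where open Separation

  connected-if-dense : ∀ {F Y} → Within F Y → 2 * ∣ Y ∣ ≤ ∣ F ∣ + 2 → ConnectedOn G Y F
  connected-if-dense {F} {Y} within dense with connected-or-separated within
  ... | inj₁ connected = connected
  ... | inj₂ (A , B , sep) with separation-counts sep
  ... | F≤ , sizes = ⊥-elim (deficiencies-too-large (separation-deficiencies sep) F≤
                              (subst (λ y → 2 * y ≤ ∣ F ∣ + 2) (sym sizes) dense))

  induced-connected : ∀ Y → 2 * ∣ Y ∣ ≤ i G Y + 2 → InducedConnected G Y
  induced-connected Y = connected-if-dense ∈inducedEdges⁻

  semi-critical-separation : ∀ {X A B} → SemiCritical G X →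
    Separation (inducedEdges G X) X A B → Deficiencies _≡_ (i G A) (i G B) ∣ A ∣ ∣ B ∣
  semi-critical-separation {X} semi sep with separation-counts sep
  ... | F≤ , sizes = deficiencies-tight (separation-deficiencies sep) F≤
                       (trans semi (cong (2 *_) (sym sizes)))

  over-critical⇒dense : ∀ Y → OverCritical G Y → 2 * ∣ Y ∣ ≤ i G Y + 2
  over-critical⇒dense Y over = ≤-trans (≤-reflexive (sym over)) (+-monoʳ-≤ (i G Y) (s≤s z≤n))

  critical-connected : ∀ X → Critical G X → InducedConnected G X
  critical-connected X critical = induced-connected X (≤-reflexive (sym critical))

  semi-critical-dichotomy : ∀ X → SemiCritical G X → InducedConnected G X
    ⊎ ∃₂ (λ A B → TwoComponents G X A B × OverCritical G A × Critical G B)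
  semi-critical-dichotomy X semi with connected-or-separated {Y = X} ∈inducedEdges⁻
  ... | inj₁ connected = inj₁ connected
  ... | inj₂ (A , B , sep) with semi-critical-separation semi sep
  ... | one-two over critical = inj₂ (A , B ,
    two-components sep (induced-connected A (over-critical⇒dense A over))
                       (critical-connected B critical) , over , critical)
  ... | two-one critical over = inj₂ (B , A ,
    two-components (separation-swap sep) (induced-connected B (over-critical⇒dense B over))
                   (critical-connected A critical) , over , critical)

  -- Part (1): with 2n - 1 edges, both G and every G - f have at least 2n - 2
  -- edges, hence are connected.
  two-edge-connected : ∣ ⊤ {m} ∣ + 1 ≡ 2 * n → TwoEdgeConnected G
  two-edge-connected edges =
    connected-if-dense everywhere dense-G , λ f → connected-if-dense everywhere (dense-G-f f)
    where
    everywhere : ∀ {F} → Within F ⊤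
    everywhere _ = ∈⊤ , ∈⊤
    2n≡m+1 : 2 * ∣ ⊤ {n} ∣ ≡ ∣ ⊤ {m} ∣ + 1
    2n≡m+1 = trans (cong (2 *_) (∣⊤∣≡n n)) (sym edges)
    dense-G : 2 * ∣ ⊤ {n} ∣ ≤ ∣ ⊤ {m} ∣ + 2
    dense-G = ≤-trans (≤-reflexive 2n≡m+1) (+-monoʳ-≤ ∣ ⊤ {m} ∣ (s≤s z≤n))
    dense-G-f : ∀ f → 2 * ∣ ⊤ {n} ∣ ≤ ∣ minusEdge G f ∣ + 2
    dense-G-f f = ≤-reflexive (trans 2n≡m+1
      (trans (cong (_+ 1) (trans (∣⊤∣≡n m) (sym (∣minusEdge∣ G f)))) (+-assoc _ 1 1)))

lemma5p2 : {n m : ℕ} (G : Graph n m) → IsP21 G →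
    TwoEdgeConnected G
    × ((X : Subset n) → Critical G X → InducedConnected G X)
    × ((X : Subset n) → SemiCritical G X →
    InducedConnected G X
    ⊎ ∃₂ (λ A B → TwoComponents G X A B × OverCritical G A × Critical G B))
lemma5p2 G ((sparse₁ , edges) , e , (sparse₂ , _)) =
  two-edge-connected edges , critical-connected , semi-critical-dichotomy
  where open Sparse21 G sparse₁ e sparse₂
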